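{- If $(c_1,\dots,c_n)$ is a solution of $(E_3)$ and there exists $i\in\{1,\dots,n\}$ with $c_i\neq0$, then $(c_1,\dots,c_n)$ is the quiddity of a weighted (3|4)-decomposition of the first kind of a convex polygon with $n$ vertices in which every sub-polygon is a triangle.
   Context: For $a_1,\dots,a_n\in\mathbb{Z}/3\mathbb{Z}$ set $M_n(a_1,\dots,a_n)=\begin{pmatrix}a_n&-1\\1&0\end{pmatrix}\cdots\begin{pmatrix}a_1&-1\\1&0\end{pmatrix}$; an $n$-tuple is a solution of $(E_3)$ if $M_n(a_1,\dots,a_n)=\pm\mathrm{Id}$ over $\mathbb{Z}/3\mathbb{Z}$. A weighted (3|4)-decomposition of the first kind of a convex polygon $P$ with $n$ vertices is a dissection of $P$ by diagonals meeting only at vertices such that every sub-polygon is either a triangle of weight $1$ or $-1$, or a quadrilateral of weight $0$ (weights in $\mathbb{Z}/3\mathbb{Z}$). Numbering the vertices $1,\dots,n$ from any vertex, clockwise or counterclockwise, its quiddity is $(c_1,\dots,c_n)$ with $c_i$ the sum of the weights of the sub-polygons having vertex $i$ as a vertex. -}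

module Defs where

open import Data.Nat using (ℕ; zero; suc; _<_)
open import Data.Vec using (Vec; []; _∷_)
open import Data.Sum using (_⊎_)
open import Relation.Binary.PropositionalEquality using (_≡_)
import Data.Nat
import Relation.Nullary

data Z3 : Set where
  z0 z1 z2 : Z3

infixl 6 _+₃_
infixl 7 _*₃_

_+₃_ : Z3 → Z3 → Z3
z0 +₃ y  = y
z1 +₃ z0 = z1
z1 +₃ z1 = z2
z1 +₃ z2 = z0
z2 +₃ z0 = z2
z2 +₃ z1 = z0
z2 +₃ z2 = z1

-₃_ : Z3 → Z3
-₃ z0 = z0
-₃ z1 = z2
-₃ z2 = z1

_*₃_ : Z3 → Z3 → Z3
z0 *₃ y = z0
z1 *₃ y = y
z2 *₃ y = -₃ y

record Mat : Set where
  constructor mat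
  field
    m11 m12 m21 m22 : Z3

_·_ : Mat → Mat → Mat
mat a b c d · mat a' b' c' d' =
  mat (a *₃ a' +₃ b *₃ c') (a *₃ b' +₃ b *₃ d')
      (c *₃ a' +₃ d *₃ c') (c *₃ b' +₃ d *₃ d')

Id : Mat
Id = mat z1 z0 z0 z1

-Id : Mat
-Id = mat z2 z0 z0 z2

Step : Z3 → Mat
Step a = mat a z2 z1 z0

M : ∀ {n} → Vec Z3 n → Mat
M []       = Id
M (a ∷ as) = M as · Step a

SolutionE3 : ∀ {n} → Vec Z3 n → Set
SolutionE3 as = (M as ≡ Id) ⊎ (M as ≡ -Id)

-- Weighted (3|4)-decompositions of the first kind all of whose
-- sub-polygons are triangles (i.e. weighted triangulations, triangle
-- weights ±1).
--
-- WTri a b : such a decomposition of the convex polygon whose vertices,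
-- in cyclic order, are a, a+1, …, b.  The side (a,b) lies in exactly one
-- triangle, with third vertex some k (a < k < b); it cuts the polygon into
-- that triangle and the polygons a,…,k and k,…,b (degenerate edges when
-- k = a+1 resp. b = k+1).

data Weight : Set where
  +1w -1w : Weight

val : Weight → Z3
val +1w = z1
val -1w = z2

data WTri : ℕ → ℕ → Set where
  edge : ∀ {a} → WTri a (suc a)
  node : ∀ {a b} (k : ℕ) → a < k → k < b →
         Weight → WTri a k → WTri k b → WTri a b

contrib : ℕ → ℕ → ℕ → Z3 → ℕ → Z3
contrib a k b w i with Data.Nat._≟_ i a | Data.Nat._≟_ i k | Data.Nat._≟_ i b
... | Relation.Nullary.yes _ | _ | _ = w
... | Relation.Nullary.no _ | Relation.Nullary.yes _ | _ = w
... | Relation.Nullary.no _ | Relation.Nullary.no _ | Relation.Nullary.yes _ = w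
... | Relation.Nullary.no _ | Relation.Nullary.no _ | Relation.Nullary.no _ = z0

quid : ∀ {a b} → WTri a b → ℕ → Z3
quid edge i = z0
quid {a} {b} (node k _ _ w l r) i =
  contrib a k b (val w) i +₃ quid l i +₃ quid r i

-- For v = ±1, Step y · Step v · Step x = ±Id · (Step (y − v) · Step (x − v)): deleting an
-- interior entry v = ±1 of a solution and subtracting v from both neighbours gives a
-- solution one entry shorter, and gluing a triangle of weight v onto a triangulation
-- realising the shorter quiddity realises the original one.  So we induct on the length,
-- cutting off one ear at a time.  A nonzero solution has a nonzero interior entry, since
-- with J = Step 0 the matrix Step c′ · Jᵏ · Step c is ±Id only for c = c′ = 0.  From
-- length 4 on the ear can be chosen so that the shorter solution is still nonzero; at
-- length 3 the shorter one is (0, 0), the quiddity of a single edge.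
module Submission where

open import Defs
open import Data.Empty using (⊥-elim)
open import Data.Fin.Base as Fin using (Fin; toℕ)
open import Data.List.Base using (List; []; _∷_; _++_; [_]; _∷ʳ_; length; initLast; _∷ʳ′_)
open import Data.List.Properties using (++-conicalʳ)
open import Data.List.Relation.Unary.All using (All; []; _∷_; all?)
open import Data.List.Relation.Unary.All.Properties using (++⁺; ¬All⇒Any¬; Any¬⇒¬All)
open import Data.List.Relation.Unary.Any using (Any; here; there; tail)
open import Data.Nat.Base using (ℕ; zero; suc; _+_; _∸_; _≤_; _<_; z≤n; s≤s)
open import Data.Nat.Properties
  using (_≟_; _<?_; suc-injective; ≤-pred; ≤-trans; ≤-antisym; <⇒≤; <-trans; ≮⇒≥; n<1+n; m<n⇒m<1+n)
open import Data.Product using (∃₂; ∃-syntax; Σ-syntax; _×_; _,_)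
open import Data.Sum as Sum using (_⊎_; inj₁; inj₂)
open import Data.Vec.Base using (Vec; []; _∷_; lookup; toList)
open import Data.Vec.Properties using (length-toList)
open import Function.Base using (_∘_)
open import Relation.Binary.Definitions using (DecidableEquality)
open import Relation.Binary.PropositionalEquality
  using (_≡_; _≢_; refl; sym; trans; cong; cong₂; subst; _≗_; module ≡-Reasoning)
open import Relation.Nullary using (¬_; Dec; yes; no)
open import Relation.Nullary.Decidable using (True; toWitness; map′; _×-dec_; _⊎-dec_; _→-dec_; ¬?)

infixl 6 _−₃_
_−₃_ : Z3 → Z3 → Z3
x −₃ y = x +₃ -₃ y

_≟₃_ : DecidableEquality Z3
z0 ≟₃ z0 = yes refl
z1 ≟₃ z1 = yes refl
z2 ≟₃ z2 = yes refl
z0 ≟₃ z1 = no λ ()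
z0 ≟₃ z2 = no λ ()
z1 ≟₃ z0 = no λ ()
z1 ≟₃ z2 = no λ ()
z2 ≟₃ z0 = no λ ()
z2 ≟₃ z1 = no λ ()

∀? : {P : Z3 → Set} → (∀ x → Dec (P x)) → Dec (∀ x → P x)
∀? P? with P? z0 | P? z1 | P? z2
... | yes p0 | yes p1 | yes p2 = yes λ { z0 → p0 ; z1 → p1 ; z2 → p2 }
... | no ¬p0 | _      | _      = no λ p → ¬p0 (p z0)
... | yes _  | no ¬p1 | _      = no λ p → ¬p1 (p z1)
... | yes _  | yes _  | no ¬p2 = no λ p → ¬p2 (p z2)

decide : {A : Set} (d : Dec A) {_ : True d} → A
decide _ {t} = toWitness t

+₃-identityʳ : ∀ x → x +₃ z0 ≡ x
+₃-identityʳ = decide (∀? λ _ → _ ≟₃ _)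

+₃-assoc : ∀ x y z → x +₃ y +₃ z ≡ x +₃ (y +₃ z)
+₃-assoc = decide (∀? λ _ → ∀? λ _ → ∀? λ _ → _ ≟₃ _)

+₃-move-last : ∀ x y z w → x +₃ (y +₃ z) +₃ w ≡ x +₃ y +₃ w +₃ z
+₃-move-last = decide (∀? λ _ → ∀? λ _ → ∀? λ _ → ∀? λ _ → _ ≟₃ _)

−₃-+₃-cancel : ∀ x y → x −₃ y +₃ y ≡ x
−₃-+₃-cancel = decide (∀? λ _ → ∀? λ _ → _ ≟₃ _)

−₃≡z0⇒≡ : ∀ x y → x −₃ y ≡ z0 → x ≡ y
−₃≡z0⇒≡ = decide (∀? λ _ → ∀? λ _ → (_ ≟₃ _) →-dec (_ ≟₃ _))

IsZero NonZero : Z3 → Set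
IsZero x = x ≡ z0
NonZero x = x ≢ z0

val≢z0 : ∀ w → NonZero (val w)
val≢z0 +1w ()
val≢z0 -1w ()

−₃-val-nonzero : ∀ {x} w → IsZero x → NonZero (x −₃ val w)
−₃-val-nonzero w x≡0 x−v≡0 = val≢z0 w (trans (sym (−₃≡z0⇒≡ _ _ x−v≡0)) x≡0)

weight-of : ∀ {x} → NonZero x → ∃[ w ] x ≡ val w
weight-of {z0} x≢0 = ⊥-elim (x≢0 refl)
weight-of {z1} _   = +1w , refl
weight-of {z2} _   = -1w , refl

_≟ₘ_ : DecidableEquality Mat
mat a b c d ≟ₘ mat a′ b′ c′ d′ =
  map′ (λ { (refl , refl , refl , refl) → refl }) (λ { refl → refl , refl , refl , refl })
       (a ≟₃ a′ ×-dec b ≟₃ b′ ×-dec c ≟₃ c′ ×-dec d ≟₃ d′)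

∀ₘ? : {P : Mat → Set} → (∀ X → Dec (P X)) → Dec (∀ X → P X)
∀ₘ? P? = map′ (λ p X → p (Mat.m11 X) (Mat.m12 X) (Mat.m21 X) (Mat.m22 X)) (λ p a b c d → p (mat a b c d))
              (∀? λ a → ∀? λ b → ∀? λ c → ∀? λ d → P? (mat a b c d))

mat-cong : ∀ {a b c d a′ b′ c′ d′} → a ≡ a′ → b ≡ b′ → c ≡ c′ → d ≡ d′ → mat a b c d ≡ mat a′ b′ c′ d′
mat-cong refl refl refl refl = refl

·-identityˡ : ∀ X → Id · X ≡ X
·-identityˡ = decide (∀ₘ? λ _ → _ ≟ₘ _)

·-identityʳ : ∀ X → X · Id ≡ X
·-identityʳ = decide (∀ₘ? λ _ → _ ≟ₘ _)

·-assoc : ∀ X Y Z → (X · Y) · Z ≡ X · (Y · Z)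
·-assoc (mat a b c d) (mat a′ b′ c′ d′) (mat a″ b″ c″ d″) =
  mat-cong (entry a b a′ c′ a″ b′ d′ c″) (entry a b a′ c′ b″ b′ d′ d″)
           (entry c d a′ c′ a″ b′ d′ c″) (entry c d a′ c′ b″ b′ d′ d″)
  where
  entry : ∀ p r q s t u w z →
          (p *₃ q +₃ r *₃ s) *₃ t +₃ (p *₃ u +₃ r *₃ w) *₃ z ≡ p *₃ (q *₃ t +₃ u *₃ z) +₃ r *₃ (s *₃ t +₃ w *₃ z)
  entry = decide (∀? λ _ → ∀? λ _ → ∀? λ _ → ∀? λ _ → ∀? λ _ → ∀? λ _ → ∀? λ _ → ∀? λ _ → _ ≟₃ _)

±Id : Mat → Set
±Id X = X ≡ Id ⊎ X ≡ -Id

±Id? : ∀ X → Dec (±Id X)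
±Id? X = X ≟ₘ Id ⊎-dec X ≟ₘ -Id

scalar : Weight → Mat
scalar +1w = Id
scalar -1w = -Id

scalar-central : ∀ w X → X · scalar w ≡ scalar w · X
scalar-central +1w X = trans (·-identityʳ X) (sym (·-identityˡ X))
scalar-central -1w   = decide (∀ₘ? λ _ → _ ≟ₘ _)

scalar-commute : ∀ w X Y → X · (scalar w · Y) ≡ scalar w · (X · Y)
scalar-commute w X Y = begin
  X · (scalar w · Y) ≡⟨ sym (·-assoc X (scalar w) Y) ⟩
  (X · scalar w) · Y ≡⟨ cong (_· Y) (scalar-central w X) ⟩
  (scalar w · X) · Y ≡⟨ ·-assoc (scalar w) X Y ⟩
  scalar w · (X · Y) ∎
  where open ≡-Reasoning

±Id-scalar-· : ∀ w X → ±Id (scalar w · X) → ±Id X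
±Id-scalar-· +1w X = subst ±Id (·-identityˡ X)
±Id-scalar-· -1w   = decide (∀ₘ? λ X → ±Id? (-Id · X) →-dec ±Id? X)

-- rotation a b = a Id + b J for J = Step z0; this form is stable under · J, so it
-- covers every product of Step z0's.
rotation : Z3 → Z3 → Mat
rotation a b = mat a (-₃ b) b a

rotation-·-Step-z0 : ∀ a b → rotation a b · Step z0 ≡ rotation (-₃ b) a
rotation-·-Step-z0 = decide (∀? λ _ → ∀? λ _ → _ ≟ₘ _)

±Id-Step-rotation-Step : ∀ c c′ a b → ±Id (((Id · Step c′) · rotation a b) · Step c) → c ≡ z0 × c′ ≡ z0
±Id-Step-rotation-Step = decide (∀? λ _ → ∀? λ _ → ∀? λ _ → ∀? λ _ → ±Id? _ →-dec (_ ≟₃ _ ×-dec _ ≟₃ _))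

Mˡ : List Z3 → Mat
Mˡ []       = Id
Mˡ (a ∷ as) = Mˡ as · Step a

M≡Mˡ∘toList : ∀ {n} (c : Vec Z3 n) → M c ≡ Mˡ (toList c)
M≡Mˡ∘toList []      = refl
M≡Mˡ∘toList (a ∷ c) = cong (_· Step a) (M≡Mˡ∘toList c)

Mˡ-++ : ∀ A B → Mˡ (A ++ B) ≡ Mˡ B · Mˡ A
Mˡ-++ []      B = sym (·-identityʳ (Mˡ B))
Mˡ-++ (a ∷ A) B = trans (cong (_· Step a) (Mˡ-++ A B)) (·-assoc (Mˡ B) (Mˡ A) (Step a))

Mˡ-infix : ∀ A R B → Mˡ (A ++ R ++ B) ≡ (Mˡ B · Mˡ R) · Mˡ A
Mˡ-infix A R B = trans (Mˡ-++ A (R ++ B)) (cong (_· Mˡ A) (Mˡ-++ R B))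

Mˡ-ear : ∀ w x y → Mˡ (x ∷ val w ∷ y ∷ []) ≡ scalar w · Mˡ (x −₃ val w ∷ y −₃ val w ∷ [])
Mˡ-ear +1w = decide (∀? λ _ → ∀? λ _ → _ ≟ₘ _)
Mˡ-ear -1w = decide (∀? λ _ → ∀? λ _ → _ ≟ₘ _)

Solution : List Z3 → Set
Solution L = ±Id (Mˡ L)

singleton-not-solution : ∀ a → ¬ Solution (a ∷ [])
singleton-not-solution = decide (∀? λ a → ¬? (±Id? (Mˡ (a ∷ []))))

Mˡ-zeros : ∀ {Z} → All IsZero Z → ∃₂ λ a b → Mˡ Z ≡ rotation a b
Mˡ-zeros []           = z1 , z0 , refl
Mˡ-zeros (refl ∷ zs) with Mˡ-zeros zs
... | a , b , eq = -₃ b , a , trans (cong (_· Step z0) eq) (rotation-·-Step-z0 a b)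

boundary-zero : ∀ c Z c′ → All IsZero Z → Solution (c ∷ Z ++ [ c′ ]) → c ≡ z0 × c′ ≡ z0
boundary-zero c Z c′ zeros sol with Mˡ-zeros zeros
... | a , b , MZ≡ = ±Id-Step-rotation-Step c c′ a b (subst ±Id MˡL≡ sol)
  where
  MˡL≡ : Mˡ (c ∷ Z ++ [ c′ ]) ≡ ((Id · Step c′) · rotation a b) · Step c
  MˡL≡ = cong (_· Step c) (trans (Mˡ-++ Z [ c′ ]) (cong ((Id · Step c′) ·_) MZ≡))

interior-nonzero : ∀ c Z c′ → Solution (c ∷ Z ++ [ c′ ]) → Any NonZero (c ∷ Z ++ [ c′ ]) → Any NonZero Z
interior-nonzero c Z c′ sol nz with all? (_≟₃ z0) Z
... | no ¬zeros = ¬All⇒Any¬ (_≟₃ z0) Z ¬zeros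
... | yes zeros with boundary-zero c Z c′ zeros sol
...   | refl , refl = ⊥-elim (Any¬⇒¬All nz (refl ∷ ++⁺ zeros (refl ∷ [])))

data Ear : List Z3 → Set where
  ear : ∀ A x w y B → Ear (A ++ x ∷ val w ∷ y ∷ B)

cut : ∀ {L} → Ear L → List Z3
cut (ear A x w y B) = A ++ x −₃ val w ∷ y −₃ val w ∷ B

length-cut : ∀ {L} (e : Ear L) → length L ≡ suc (length (cut e))
length-cut (ear []      x w y B) = refl
length-cut (ear (a ∷ A) x w y B) = cong suc (length-cut (ear A x w y B))

cut-solution : ∀ {L} (e : Ear L) → Solution L → Solution (cut e)
cut-solution (ear A x w y B) = ±Id-scalar-· w _ ∘ subst ±Id Mˡ≡
  where
  open ≡-Reasoning
  S = scalar w
  R = x ∷ val w ∷ y ∷ []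
  R′ = x −₃ val w ∷ y −₃ val w ∷ []
  Mˡ≡ : Mˡ (A ++ R ++ B) ≡ S · Mˡ (A ++ R′ ++ B)
  Mˡ≡ = begin
    Mˡ (A ++ R ++ B)             ≡⟨ Mˡ-infix A R B ⟩
    (Mˡ B · Mˡ R) · Mˡ A         ≡⟨ cong (λ Q → (Mˡ B · Q) · Mˡ A) (Mˡ-ear w x y) ⟩
    (Mˡ B · (S · Mˡ R′)) · Mˡ A  ≡⟨ cong (_· Mˡ A) (scalar-commute w (Mˡ B) (Mˡ R′)) ⟩
    (S · (Mˡ B · Mˡ R′)) · Mˡ A  ≡⟨ ·-assoc S (Mˡ B · Mˡ R′) (Mˡ A) ⟩
    S · ((Mˡ B · Mˡ R′) · Mˡ A)  ≡⟨ cong (S ·_) (sym (Mˡ-infix A R′ B)) ⟩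
    S · Mˡ (A ++ R′ ++ B)        ∎

GoodEar : List Z3 → Set
GoodEar L = Σ[ e ∈ Ear L ] Any NonZero (cut e)

good-ear-∷ : ∀ {L} c → GoodEar L → GoodEar (c ∷ L)
good-ear-∷ c (ear A x w y B , nz) = ear (c ∷ A) x w y B , there nz

-- Cutting at v leaves only zeros exactly when the tuple is v, v, v, 0, …, 0; then the
-- ear at the second v is good.
head-ear : ∀ c w y B → c ≡ z0 ⊎ B ≢ [] → GoodEar (c ∷ val w ∷ y ∷ B)
head-ear c w y B h with all? (_≟₃ z0) (c −₃ val w ∷ y −₃ val w ∷ B)
... | no ¬zeros = ear [] c w y B , ¬All⇒Any¬ (_≟₃ z0) _ ¬zeros
... | yes (c−v≡0 ∷ y−v≡0 ∷ zeros) = recentre h (−₃≡z0⇒≡ y _ y−v≡0) zeros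
  where
  recentre : ∀ {y B} → c ≡ z0 ⊎ B ≢ [] → y ≡ val w → All IsZero B → GoodEar (c ∷ val w ∷ y ∷ B)
  recentre (inj₁ c≡0)  _    _          = ⊥-elim (−₃-val-nonzero w c≡0 c−v≡0)
  recentre (inj₂ B≢[]) _    []         = ⊥-elim (B≢[] refl)
  recentre (inj₂ _)    refl (b≡0 ∷ _) = ear [ c ] (val w) w _ _ , there (there (here (−₃-val-nonzero w b≡0)))

good-ear : ∀ c Z c′ → c ≡ z0 ⊎ 2 ≤ length Z → Any NonZero Z → GoodEar (c ∷ Z ++ [ c′ ])
good-ear c (z ∷ Z) c′ h nz with z ≟₃ z0
... | yes refl = good-ear-∷ c (good-ear z0 Z c′ (inj₁ refl) (tail (λ z≢0 → z≢0 refl) nz))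
... | no z≢0 with weight-of z≢0
...   | w , refl = head-ear-∷ʳ Z (Sum.map₂ ≤-pred h)
  where
  head-ear-∷ʳ : ∀ Z → c ≡ z0 ⊎ 1 ≤ length Z → GoodEar (c ∷ val w ∷ Z ++ [ c′ ])
  head-ear-∷ʳ []      h = head-ear c w c′ [] (Sum.map₂ (λ ()) h)
  head-ear-∷ʳ (y ∷ Z) h = head-ear c w y (Z ++ [ c′ ]) (Sum.map₂ (λ _ → (λ ()) ∘ ++-conicalʳ Z [ c′ ]) h)

length-∷ʳ : ∀ (Z : List Z3) c → length (Z ∷ʳ c) ≡ suc (length Z)
length-∷ʳ []      c = refl
length-∷ʳ (z ∷ Z) c = cong suc (length-∷ʳ Z c)

find-good-ear : ∀ L → 4 ≤ length L → Solution L → Any NonZero L → GoodEar L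
find-good-ear (c ∷ R) len sol nz with initLast R
... | []       = ⊥-elim (1≱4 len)
  where
  1≱4 : ¬ 4 ≤ 1
  1≱4 (s≤s ())
... | Z ∷ʳ′ c′ = good-ear c Z c′ (inj₂ 2≤|Z|) (interior-nonzero c Z c′ sol nz)
  where
  2≤|Z| : 2 ≤ length Z
  2≤|Z| = ≤-pred (≤-pred (subst (4 ≤_) (cong suc (length-∷ʳ Z c′)) len))

-- Reading past the end of the list gives z0, as quid does off the polygon.
nth : List Z3 → ℕ → Z3
nth []      _       = z0
nth (x ∷ _) zero    = x
nth (_ ∷ L) (suc p) = nth L p

nth-zeros : ∀ {L} → All IsZero L → ∀ p → nth L p ≡ z0
nth-zeros []            _       = refl
nth-zeros (x≡0 ∷ _)     zero    = x≡0
nth-zeros (_   ∷ zeros) (suc p) = nth-zeros zeros p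

nth-nonzero : ∀ L p → NonZero (nth L p) → Any NonZero L
nth-nonzero []      _       nz = ⊥-elim (nz refl)
nth-nonzero (_ ∷ _) zero    nz = here nz
nth-nonzero (_ ∷ L) (suc p) nz = there (nth-nonzero L p nz)

nth-toList : ∀ {n} (c : Vec Z3 n) (i : Fin n) → nth (toList c) (toℕ i) ≡ lookup c i
nth-toList (a ∷ c) Fin.zero    = refl
nth-toList (a ∷ c) (Fin.suc i) = nth-toList c i

Triangulable : ℕ → List Z3 → Set
Triangulable n L = Σ[ T ∈ WTri 0 n ] quid T ≗ nth L

zeros-triangulable : ∀ {L} → All IsZero L → Triangulable 1 L
zeros-triangulable zeros = edge , λ p → sym (nth-zeros zeros p)

punchIn : ℕ → ℕ → ℕ
punchIn zero    p       = suc p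
punchIn (suc j) zero    = zero
punchIn (suc j) (suc p) = suc (punchIn j p)

punchIn-injective : ∀ j {p q} → punchIn j p ≡ punchIn j q → p ≡ q
punchIn-injective zero    eq = suc-injective eq
punchIn-injective (suc j) {zero}  {zero}  _  = refl
punchIn-injective (suc j) {suc p} {suc q} eq = cong suc (punchIn-injective j (suc-injective eq))

punchIn≢ : ∀ j p → punchIn j p ≢ j
punchIn≢ (suc j) (suc p) eq = punchIn≢ j p (suc-injective eq)

punchIn-< : ∀ {j p} → p < j → punchIn j p ≡ p
punchIn-< {suc j} {zero}  _         = refl
punchIn-< {suc j} {suc p} (s≤s p<j) = cong suc (punchIn-< p<j)

punchIn-≥ : ∀ {j p} → j ≤ p → punchIn j p ≡ suc p
punchIn-≥ {zero}          _         = refl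
punchIn-≥ {suc j} {suc p} (s≤s j≤p) = cong suc (punchIn-≥ j≤p)

punchIn-view : ∀ j y → y ≡ j ⊎ ∃[ p ] punchIn j p ≡ y
punchIn-view zero    zero    = inj₁ refl
punchIn-view zero    (suc y) = inj₂ (y , refl)
punchIn-view (suc j) zero    = inj₂ (zero , refl)
punchIn-view (suc j) (suc y) = Sum.map (cong suc) (λ (p , eq) → suc p , cong suc eq) (punchIn-view j y)

insertZero : ℕ → (ℕ → Z3) → ℕ → Z3
insertZero zero    f zero    = z0
insertZero zero    f (suc y) = f y
insertZero (suc j) f zero    = f zero
insertZero (suc j) f (suc y) = insertZero j (f ∘ suc) y

insertZero-self : ∀ j f → insertZero j f j ≡ z0
insertZero-self zero    f = refl
insertZero-self (suc j) f = insertZero-self j (f ∘ suc)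

insertZero-punchIn : ∀ j f p → insertZero j f (punchIn j p) ≡ f p
insertZero-punchIn zero    f p       = refl
insertZero-punchIn (suc j) f zero    = refl
insertZero-punchIn (suc j) f (suc p) = insertZero-punchIn j (f ∘ suc) p

insertZero-cong : ∀ j {f g} → f ≗ g → insertZero j f ≗ insertZero j g
insertZero-cong zero    f≗g zero    = refl
insertZero-cong zero    f≗g (suc y) = f≗g y
insertZero-cong (suc j) f≗g zero    = f≗g zero
insertZero-cong (suc j) f≗g (suc y) = insertZero-cong j (f≗g ∘ suc) y

insertZero-z0 : ∀ j y → insertZero j (λ _ → z0) y ≡ z0
insertZero-z0 zero    zero    = refl
insertZero-z0 zero    (suc y) = refl
insertZero-z0 (suc j) zero    = refl
insertZero-z0 (suc j) (suc y) = insertZero-z0 j y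

insertZero-+ : ∀ j f g y → insertZero j (λ i → f i +₃ g i) y ≡ insertZero j f y +₃ insertZero j g y
insertZero-+ zero    f g zero    = refl
insertZero-+ zero    f g (suc y) = refl
insertZero-+ (suc j) f g zero    = refl
insertZero-+ (suc j) f g (suc y) = insertZero-+ j (f ∘ suc) (g ∘ suc) y

Corner : ℕ → ℕ → ℕ → ℕ → Set
Corner a k b i = i ≡ a ⊎ i ≡ k ⊎ i ≡ b

¬Corner : ∀ {a k b i} → i ≢ a → i ≢ k → i ≢ b → ¬ Corner a k b i
¬Corner i≢a _   _   (inj₁ i≡a)        = i≢a i≡a
¬Corner _   i≢k _   (inj₂ (inj₁ i≡k)) = i≢k i≡k
¬Corner _   _   i≢b (inj₂ (inj₂ i≡b)) = i≢b i≡b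

contrib-corner : ∀ a k b v i → Corner a k b i → contrib a k b v i ≡ v
contrib-corner a k b v i corner with i ≟ a | i ≟ k | i ≟ b
... | yes _  | _      | _      = refl
... | no _   | yes _  | _      = refl
... | no _   | no _   | yes _  = refl
... | no i≢a | no i≢k | no i≢b = ⊥-elim (¬Corner i≢a i≢k i≢b corner)

contrib-¬corner : ∀ a k b v i → ¬ Corner a k b i → contrib a k b v i ≡ z0
contrib-¬corner a k b v i ¬corner with i ≟ a | i ≟ k | i ≟ b
... | yes i≡a | _       | _       = ⊥-elim (¬corner (inj₁ i≡a))
... | no _    | yes i≡k | _       = ⊥-elim (¬corner (inj₂ (inj₁ i≡k)))
... | no _    | no _    | yes i≡b = ⊥-elim (¬corner (inj₂ (inj₂ i≡b)))
... | no _    | no _    | no _    = refl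

contrib-injective : ∀ {f : ℕ → ℕ} → (∀ {p q} → f p ≡ f q → p ≡ q) →
                    ∀ a k b v i → contrib (f a) (f k) (f b) v (f i) ≡ contrib a k b v i
contrib-injective {f} f-inj a k b v i with i ≟ a | i ≟ k | i ≟ b
... | yes i≡a | _       | _       = contrib-corner _ _ _ v _ (inj₁ (cong f i≡a))
... | no _    | yes i≡k | _       = contrib-corner _ _ _ v _ (inj₂ (inj₁ (cong f i≡k)))
... | no _    | no _    | yes i≡b = contrib-corner _ _ _ v _ (inj₂ (inj₂ (cong f i≡b)))
... | no i≢a  | no i≢k  | no i≢b  =
  contrib-¬corner _ _ _ v _ (¬Corner (i≢a ∘ f-inj) (i≢k ∘ f-inj) (i≢b ∘ f-inj))

contrib-insertZero : ∀ {j a k b a′ k′ b′} v → punchIn j a ≡ a′ → punchIn j k ≡ k′ → punchIn j b ≡ b′ →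
                     contrib a′ k′ b′ v ≗ insertZero j (contrib a k b v)
contrib-insertZero {j} {a} {k} {b} v refl refl refl y with punchIn-view j y
... | inj₁ refl =
  trans (contrib-¬corner _ _ _ v j (¬Corner (punchIn≢ j a ∘ sym) (punchIn≢ j k ∘ sym) (punchIn≢ j b ∘ sym)))
        (sym (insertZero-self j _))
... | inj₂ (p , refl) =
  trans (contrib-injective (punchIn-injective j) a k b v p) (sym (insertZero-punchIn j _ p))

shift : ∀ {a b} → WTri a b → WTri (suc a) (suc b)
shift edge                   = edge
shift (node k a<k k<b w l r) = node (suc k) (s≤s a<k) (s≤s k<b) w (shift l) (shift r)

insertZero-quid-node : ∀ j {a b} k (a<k : a < k) (k<b : k < b) w (l : WTri a k) (r : WTri k b) y →
  insertZero j (quid (node k a<k k<b w l r)) y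
    ≡ insertZero j (contrib a k b (val w)) y +₃ insertZero j (quid l) y +₃ insertZero j (quid r) y
insertZero-quid-node j {a} {b} k _ _ w l r y =
  trans (insertZero-+ j (λ i → contrib a k b (val w) i +₃ quid l i) (quid r) y)
        (cong (_+₃ insertZero j (quid r) y) (insertZero-+ j (contrib a k b (val w)) (quid l) y))

quid-shift : ∀ {j a b} (T : WTri a b) → j ≤ a → quid (shift T) ≗ insertZero j (quid T)
quid-shift {j} edge _ y = sym (insertZero-z0 j y)
quid-shift {j} (node k a<k k<b w l r) j≤a y =
  trans (cong₂ _+₃_ (cong₂ _+₃_ (contrib-insertZero (val w) (punchIn-≥ j≤a) (punchIn-≥ j≤k) (punchIn-≥ j≤b) y)
                                 (quid-shift l j≤a y))
                    (quid-shift r j≤k y))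
        (sym (insertZero-quid-node j k a<k k<b w l r y))
  where
  j≤k = ≤-trans j≤a (<⇒≤ a<k)
  j≤b = ≤-trans j≤k (<⇒≤ k<b)

quid-below : ∀ {j a b} (T : WTri a b) → b < j → quid T ≗ insertZero j (quid T)
quid-below {j} edge _ y = sym (insertZero-z0 j y)
quid-below {j} (node k a<k k<b w l r) b<j y =
  trans (cong₂ _+₃_ (cong₂ _+₃_ (contrib-insertZero (val w) (punchIn-< a<j) (punchIn-< k<j) (punchIn-< b<j) y)
                                 (quid-below l k<j y))
                    (quid-below r b<j y))
        (sym (insertZero-quid-node j k a<k k<b w l r y))
  where
  k<j = <-trans k<b b<j
  a<j = <-trans a<k k<j

-- ins i w T glues a triangle of weight w onto the side (i, i+1) of T, whose
-- vertices after i move up by one.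
ins : ∀ {a b} (i : ℕ) → Weight → a ≤ i → i < b → WTri a b → WTri a (suc b)
ins i w _ _ (edge {a}) = node (suc a) (n<1+n a) (n<1+n (suc a)) w edge edge
ins i w a≤i i<b (node k a<k k<b w′ l r) with i <? k
... | yes i<k = node (suc k) (m<n⇒m<1+n a<k) (s≤s k<b) w′ (ins i w a≤i i<k l) (shift r)
... | no i≮k  = node k a<k (m<n⇒m<1+n k<b) w′ l (ins i w (≮⇒≥ i≮k) i<b r)

triangle-quid : ℕ → Weight → ℕ → Z3
triangle-quid i w = contrib i (suc i) (suc (suc i)) (val w)

quid-ins : ∀ {a b} i w (a≤i : a ≤ i) (i<b : i < b) (T : WTri a b) y →
  quid (ins i w a≤i i<b T) y ≡ insertZero (suc i) (quid T) y +₃ triangle-quid i w y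
quid-ins i w a≤i i<b (edge {a}) y with ≤-antisym (≤-pred i<b) a≤i
... | refl = trans (trans (+₃-identityʳ (E +₃ z0)) (+₃-identityʳ E)) (cong (_+₃ E) (sym (insertZero-z0 (suc i) y)))
  where
  E = triangle-quid i w y
quid-ins i w a≤i i<b (node k a<k k<b w′ l r) y with i <? k
... | yes i<k =
  begin
    contrib _ (suc k) _ (val w′) y +₃ quid (ins i w a≤i i<k l) y +₃ quid (shift r) y
  ≡⟨ cong₂ _+₃_ (cong₂ _+₃_ (contrib-insertZero (val w′) (punchIn-< (s≤s a≤i)) (punchIn-≥ i<k) (punchIn-≥ i<b) y)
                            (quid-ins i w a≤i i<k l y))
                (quid-shift r i<k y) ⟩
    C +₃ (L +₃ E) +₃ R
  ≡⟨ +₃-move-last C L E R ⟩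
    C +₃ L +₃ R +₃ E
  ≡⟨ cong (_+₃ E) (sym (insertZero-quid-node (suc i) k a<k k<b w′ l r y)) ⟩
    insertZero (suc i) (quid (node k a<k k<b w′ l r)) y +₃ E
  ∎
  where
  open ≡-Reasoning
  C = insertZero (suc i) (contrib _ k _ (val w′)) y
  L = insertZero (suc i) (quid l) y
  R = insertZero (suc i) (quid r) y
  E = triangle-quid i w y
... | no i≮k =
  begin
    contrib _ k _ (val w′) y +₃ quid l y +₃ quid (ins i w k≤i i<b r) y
  ≡⟨ cong₂ _+₃_ (cong₂ _+₃_ (contrib-insertZero (val w′) (punchIn-< (s≤s a≤i)) (punchIn-< (s≤s k≤i)) (punchIn-≥ i<b) y)
                            (quid-below l (s≤s k≤i) y))
                (quid-ins i w k≤i i<b r y) ⟩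
    C +₃ L +₃ (R +₃ E)
  ≡⟨ sym (+₃-assoc (C +₃ L) R E) ⟩
    C +₃ L +₃ R +₃ E
  ≡⟨ cong (_+₃ E) (sym (insertZero-quid-node (suc i) k a<k k<b w′ l r y)) ⟩
    insertZero (suc i) (quid (node k a<k k<b w′ l r)) y +₃ E
  ∎
  where
  open ≡-Reasoning
  k≤i = ≮⇒≥ i≮k
  C = insertZero (suc i) (contrib _ k _ (val w′)) y
  L = insertZero (suc i) (quid l) y
  R = insertZero (suc i) (quid r) y
  E = triangle-quid i w y

nth-cut : ∀ A x w y B p →
  nth (A ++ x ∷ val w ∷ y ∷ B) p
    ≡ insertZero (suc (length A)) (nth (A ++ x −₃ val w ∷ y −₃ val w ∷ B)) p
      +₃ triangle-quid (length A) w p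
nth-cut []      x w y B zero                = sym (−₃-+₃-cancel x (val w))
nth-cut []      x w y B (suc zero)          = refl
nth-cut []      x w y B (suc (suc zero))    = sym (−₃-+₃-cancel y (val w))
nth-cut []      x w y B (suc (suc (suc p))) = sym (+₃-identityʳ (nth B p))
nth-cut (a ∷ A) x w y B zero                = sym (+₃-identityʳ a)
nth-cut (a ∷ A) x w y B (suc p)             =
  trans (nth-cut A x w y B p)
        (cong (insertZero (suc (length A)) (nth (A ++ x −₃ val w ∷ y −₃ val w ∷ B)) p +₃_)
              (sym (contrib-injective suc-injective _ _ _ (val w) p)))

length-ear : ∀ (A : List Z3) {x v y B} → 3 + length A ≤ length (A ++ x ∷ v ∷ y ∷ B)
length-ear []      = s≤s (s≤s (s≤s z≤n))
length-ear (a ∷ A) = s≤s (length-ear A)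

ear-step : ∀ {n L} (e : Ear L) → length L ≡ suc (suc n) → Triangulable n (cut e) → Triangulable (suc n) L
ear-step {n} (ear A x w y B) len (T , T≗) = ins i w z≤n i<n T , λ p →
  begin
    quid (ins i w z≤n i<n T) p
  ≡⟨ quid-ins i w z≤n i<n T p ⟩
    insertZero (suc i) (quid T) p +₃ triangle-quid i w p
  ≡⟨ cong (_+₃ triangle-quid i w p) (insertZero-cong (suc i) T≗ p) ⟩
    insertZero (suc i) (nth (A ++ x −₃ val w ∷ y −₃ val w ∷ B)) p +₃ triangle-quid i w p
  ≡⟨ sym (nth-cut A x w y B p) ⟩
    nth (A ++ x ∷ val w ∷ y ∷ B) p
  ∎
  where
  open ≡-Reasoning
  i = length A
  i<n : i < n
  i<n = ≤-pred (≤-pred (subst (3 + i ≤_) len (length-ear A {x} {val w} {y} {B})))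

triangulate₃ : ∀ a b c → Solution (a ∷ b ∷ c ∷ []) → Any NonZero (a ∷ b ∷ c ∷ []) → Triangulable 2 (a ∷ b ∷ c ∷ [])
triangulate₃ a b c sol nz with interior-nonzero a [ b ] c sol nz
... | here b≢0 with weight-of b≢0
...   | w , refl with boundary-zero _ [] _ [] (cut-solution (ear [] a w c []) sol)
...     | a−v≡0 , c−v≡0 = ear-step (ear [] a w c []) refl (zeros-triangulable (a−v≡0 ∷ c−v≡0 ∷ []))

triangulate : ∀ m L → length L ≡ 3 + m → Solution L → Any NonZero L → Triangulable (2 + m) L
triangulate zero    (a ∷ b ∷ c ∷ []) refl sol nz = triangulate₃ a b c sol nz
triangulate (suc m) L len sol nz with find-good-ear L (subst (4 ≤_) (sym len) (s≤s (s≤s (s≤s (s≤s z≤n))))) sol nz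
... | e , nz′ =
  ear-step e len (triangulate m (cut e) (suc-injective (trans (sym (length-cut e)) len)) (cut-solution e sol) nz′)

proposition4p7 : (n : ℕ) (c : Vec Z3 n) → SolutionE3 c →
    (∃[ i ] lookup c i ≢ z0) →
    ∃[ t ] ((i : Fin n) → quid {0} {n ∸ 1} t (toℕ i) ≡ lookup c i)
proposition4p7 0 [] _ (() , _)
proposition4p7 1 (a ∷ []) sol _ = ⊥-elim (singleton-not-solution a sol)
proposition4p7 2 (a ∷ b ∷ []) sol (i , ci≢0) with boundary-zero a [] b [] sol
... | refl , refl = ⊥-elim (ci≢0 (trans (sym (nth-toList (z0 ∷ z0 ∷ []) i)) (nth-zeros (refl ∷ refl ∷ []) (toℕ i))))
proposition4p7 (suc (suc (suc m))) c sol (i , ci≢0)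
  with triangulate m (toList c) (length-toList c) (subst ±Id (M≡Mˡ∘toList c) sol)
                   (nth-nonzero (toList c) (toℕ i) (ci≢0 ∘ trans (sym (nth-toList c i))))
... | T , T≗ = T , λ j → trans (T≗ (toℕ j)) (nth-toList c j)
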